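{- Let $i$ be an inert term. For any inert multi type $M$ there exists a nonempty inert type derivation $\pi\triangleright\Gamma\vdash i:M$ (i.e. $\Gamma$ is an inert type context with $\mathrm{dom}(\Gamma)\neq\emptyset$).
   Context: Terms: $t,u ::= x \mid \lambda x.t \mid tu$, up to $\alpha$-equivalence. Values: $v ::= x \mid \lambda x.t$. Fireballs $f$ and inert terms $i$ are defined by mutual induction: $f ::= v \mid i$ and $i ::= x f_1 \dots f_n$ with $n>0$ (application left-associative). Multi types: linear types $L ::= M\multimap N$; multi types $M,N ::= [L_1,\dots,L_n]$ (finite multisets, $n\ge 0$); $\mathbf 0$ empty multiset, $\uplus$ multiset sum. Type context $\Gamma$: total map from variables to multi types with finite $\mathrm{dom}(\Gamma)=\{x\mid \Gamma(x)\ne\mathbf 0\}$; $(\Gamma\uplus\Delta)(x)=\Gamma(x)\uplus\Delta(x)$; $x:M$ maps $x$ to $M$ and all else to $\mathbf 0$; $\Gamma,x:M$ extends $\Gamma$ ($x\notin\mathrm{dom}(\Gamma)$) by $x\mapsto M$. Typing rules: (ax) $x:M\vdash x:M$; (@) from $\Gamma\vdash t:[M\multimap N]$ and $\Delta\vdash u:M$ infer $\Gamma\uplus\Delta\vdash tu:N$; ($\lambda$) from $\Gamma_k,x:M_k\vdash t:N_k$ for $k=1,\dots,n$ ($n\ge0$) infer $\Gamma_1\uplus\dots\uplus\Gamma_n\vdash\lambda x.t:[M_1\multimap N_1,\dots,M_n\multimap N_n]$. Inert multi types are defined inductively as finite multisets (possibly empty) of linear types $\mathbf 0\multimap N$ with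 $N$ an inert multi type; a type context is inert if all its values are inert multi types. A derivation $\pi\triangleright\Gamma\vdash e:M$ is inert if $\Gamma$ and $M$ are inert, and nonempty if $\mathrm{dom}(\Gamma)\neq\emptyset$. -}

module Defs where

open import Data.Nat using (ℕ; suc)
open import Data.Fin using (Fin; zero; suc; _≟_)
open import Data.List using (List; []; _∷_; _++_)
open import Relation.Nullary using (yes; no)

-- Terms, well-scoped de Bruijn (so alpha-equivalence is syntactic equality).
-- Term n : terms with free variables among Fin n.
data Term (n : ℕ) : Set where
  var : Fin n → Term n
  ƛ_  : Term (suc n) → Term n
  _·_ : Term n → Term n → Term n

infixl 7 _·_

data Value {n : ℕ} : Term n → Set where
  var : (x : Fin n) → Value (var x)
  lam : (t : Term (suc n)) → Value (ƛ t)

mutual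
  data Fireball {n : ℕ} : Term n → Set where
    val   : {t : Term n} → Value t → Fireball t
    inert : {t : Term n} → Inert t → Fireball t

  data Inert {n : ℕ} : Term n → Set where
    head : (x : Fin n) {f : Term n} → Fireball f → Inert (var x · f)
    step : {i f : Term n} → Inert i → Fireball f → Inert (i · f)

-- Multi types: finite multisets represented as lists of linear types.
data LType : Set where
  _⊸_ : List LType → List LType → LType

MType : Set
MType = List LType

𝟘 : MType
𝟘 = []

Ctx : ℕ → Set
Ctx n = Fin n → MType

∅ : {n : ℕ} → Ctx n
∅ _ = 𝟘

_⊎_ : {n : ℕ} → Ctx n → Ctx n → Ctx n
(Γ ⊎ Δ) x = Γ x ++ Δ x

_↦_ : {n : ℕ} → Fin n → MType → Ctx n
(x ↦ M) y with y ≟ x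
... | yes _ = M
... | no  _ = 𝟘

_▸_ : {n : ℕ} → Ctx n → MType → Ctx (suc n)
(Γ ▸ M) zero    = M
(Γ ▸ M) (suc y) = Γ y

mutual
  data _⊢_∶_ {n : ℕ} : Ctx n → Term n → MType → Set where
    ax  : (x : Fin n) (M : MType) → (x ↦ M) ⊢ var x ∶ M
    app : {Γ Δ : Ctx n} {t u : Term n} {M N : MType} →
          Γ ⊢ t ∶ ((M ⊸ N) ∷ []) → Δ ⊢ u ∶ M → (Γ ⊎ Δ) ⊢ t · u ∶ N
    lam : {Γ : Ctx n} {t : Term (suc n)} {L : MType} →
          LamPremises Γ t L → Γ ⊢ ƛ t ∶ L

  -- the n ≥ 0 premises  Γ_k , x : M_k ⊢ t : N_k  of the λ rule,
  -- concluding context Γ_1 ⊎ ... ⊎ Γ_n and type [M_1 ⊸ N_1, ..., M_n ⊸ N_n]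
  data LamPremises {n : ℕ} : Ctx n → Term (suc n) → MType → Set where
    []  : {t : Term (suc n)} → LamPremises ∅ t []
    _∷_ : {Γ Δ : Ctx n} {t : Term (suc n)} {M N : MType} {L : MType} →
          (Γ ▸ M) ⊢ t ∶ N → LamPremises Δ t L →
          LamPremises (Γ ⊎ Δ) t ((M ⊸ N) ∷ L)

data InertM : MType → Set where
  []  : InertM []
  _∷_ : {N L : MType} → InertM N → InertM L → InertM ((𝟘 ⊸ N) ∷ L)

InertCtx : {n : ℕ} → Ctx n → Set
InertCtx Γ = ∀ x → InertM (Γ x)

-- Induction on the inert term, typing every fireball argument with the empty
-- multi type 𝟘 (variables by (ax), abstractions by (λ) with no premises, inert
-- terms by induction). The head variable x of x f₁ … fₖ then receives the
-- arrow type 𝟘 ⊸ (𝟘 ⊸ … (𝟘 ⊸ M)), so x is in the domain of the context.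
module Submission where

open import Defs
open import Data.Nat using (ℕ)
open import Data.Fin using (Fin; _≟_)
open import Data.List using ([]; _∷_; _++_)
open import Data.Product using (Σ; ∃; _×_; _,_)
open import Relation.Binary.PropositionalEquality using (_≡_; _≢_; refl; sym; subst)
open import Relation.Nullary using (yes; no; contradiction)

NonemptyCtx : {n : ℕ} → Ctx n → Set
NonemptyCtx Γ = ∃ λ x → Γ x ≢ 𝟘

InertM-++ : {M N : MType} → InertM M → InertM N → InertM (M ++ N)
InertM-++ []      n = n
InertM-++ (l ∷ m) n = l ∷ InertM-++ m n

InertCtx-∅ : {n : ℕ} → InertCtx (∅ {n})
InertCtx-∅ _ = []

InertCtx-⊎ : {n : ℕ} {Γ Δ : Ctx n} → InertCtx Γ → InertCtx Δ → InertCtx (Γ ⊎ Δ)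
InertCtx-⊎ γ δ x = InertM-++ (γ x) (δ x)

InertCtx-↦ : {n : ℕ} (x : Fin n) {M : MType} → InertM M → InertCtx (x ↦ M)
InertCtx-↦ x m y with y ≟ x
... | yes _ = m
... | no  _ = []

↦-self : {n : ℕ} (x : Fin n) (M : MType) → (x ↦ M) x ≡ M
↦-self x M with x ≟ x
... | yes _   = refl
... | no  x≢x = contradiction refl x≢x

++-≢𝟘 : {M N : MType} → M ≢ 𝟘 → M ++ N ≢ 𝟘
++-≢𝟘 {[]}    M≢𝟘 = contradiction refl M≢𝟘
++-≢𝟘 {_ ∷ _} _   = λ ()

NonemptyCtx-⊎ˡ : {n : ℕ} {Γ : Ctx n} (Δ : Ctx n) → NonemptyCtx Γ → NonemptyCtx (Γ ⊎ Δ)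
NonemptyCtx-⊎ˡ _ (x , Γx≢𝟘) = x , ++-≢𝟘 Γx≢𝟘

NonemptyCtx-↦ : {n : ℕ} (x : Fin n) {M : MType} → M ≢ 𝟘 → NonemptyCtx (x ↦ M)
NonemptyCtx-↦ x {M} M≢𝟘 = x , subst (_≢ 𝟘) (sym (↦-self x M)) M≢𝟘

InertTyping : {n : ℕ} → Term n → MType → Set
InertTyping {n} t M = Σ (Ctx n) λ Γ → (Γ ⊢ t ∶ M) × InertCtx Γ

NonemptyInertTyping : {n : ℕ} → Term n → MType → Set
NonemptyInertTyping {n} t M =
  Σ (Ctx n) λ Γ → Σ (Γ ⊢ t ∶ M) λ _ → InertCtx Γ × NonemptyCtx Γ

var-typable : {n : ℕ} (x : Fin n) {L : LType} {M : MType} → InertM (L ∷ M) →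
              NonemptyInertTyping (var x) (L ∷ M)
var-typable x m = x ↦ _ , ax x _ , InertCtx-↦ x m , NonemptyCtx-↦ x λ ()

app-typable : {n : ℕ} {t u : Term n} {M : MType} →
              NonemptyInertTyping t ((𝟘 ⊸ M) ∷ []) → InertTyping u 𝟘 →
              NonemptyInertTyping (t · u) M
app-typable (Γ , π , γ , Γ≠∅) (Δ , ρ , δ) =
  Γ ⊎ Δ , app π ρ , InertCtx-⊎ γ δ , NonemptyCtx-⊎ˡ Δ Γ≠∅

mutual
  fireball-typable-𝟘 : {n : ℕ} {f : Term n} → Fireball f → InertTyping f 𝟘
  fireball-typable-𝟘 (val (var x))   = x ↦ 𝟘 , ax x 𝟘 , InertCtx-↦ x []
  fireball-typable-𝟘 (val (lam t))   = ∅ , lam [] , InertCtx-∅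
  fireball-typable-𝟘 (inert i) with inert-typable i []
  ... | Γ , π , γ , _ = Γ , π , γ

  inert-typable : {n : ℕ} {i : Term n} {M : MType} → Inert i → InertM M →
                  NonemptyInertTyping i M
  inert-typable (head x f) m = app-typable (var-typable x (m ∷ [])) (fireball-typable-𝟘 f)
  inert-typable (step i f) m = app-typable (inert-typable i (m ∷ [])) (fireball-typable-𝟘 f)

lemma5 : {n : ℕ} (i : Term n) → Inert i → (M : MType) → InertM M →
         Σ (Ctx n) (λ Γ → Σ (Γ ⊢ i ∶ M) (λ π →
           InertCtx Γ × ∃ (λ (x : Fin n) → Γ x ≢ 𝟘)))
lemma5 _ i _ m = inert-typable i m
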